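{- Let $X$ and $Y$ be finite disjoint sets and $Q$ a partial order relation on $Y$. Let $\mathfrak{F}^*_Q(X,Y) = \{(P,f) \in \mathfrak{F}_Q(X,Y) : X = \bigcup_{y \in Y} f(y)\}$. Then the mapping $\Phi$ restricts to a bijection between $\mathfrak{F}^*_Q(X,Y)$ and $\mathfrak{M}^*_Q(X,Y)$.
   Context: A partial order relation (p.o.r.) on $S$ is a reflexive, antisymmetric, transitive subset of $S\times S$; $\mathfrak{P}(S)$ is the set of p.o.r.s on $S$. $R|_M = R \cap (M\times M)$. Lower end of $R$: $L$ with $(x,l)\in R$, $l\in L \Rightarrow x\in L$; $\mathcal{L}(R)$ the set of lower ends. Upper end: $U$ with $u\in U$, $(u,x)\in R\Rightarrow x\in U$. Convex: $(a,x),(x,b)\in R$, $a,b\in M$ imply $x\in M$. $\max R$: set of maximal points of $R$. $\mathfrak{U}(X,Y) = \{R\in\mathfrak{P}(X\cup Y): Y \text{ upper end of } R\}$; $\mathfrak{C}_Q(X,Y) = \{R\in\mathfrak{P}(X\cup Y): R|_Y = Q,\ Y \text{ convex in } R\}$; $\mathfrak{M}_Q(X,Y) = \mathfrak{U}(X,Y)\cap\mathfrak{C}_Q(X,Y)$; $\mathfrak{M}^*_Q(X,Y) = \{R \in \mathfrak{C}_Q(X,Y) : \max Q = \max R\}$. $\mathfrak{F}_Q(X,Y)$ is the set of pairs $(P,f)$ with $P\in\mathfrak{P}(X)$ and $f: Y\to\mathcal{L}(P)$ such that $(a,b)\in Q \Rightarrow f(a)\subseteq f(b)$. $\Phi : \mathfrak{F}_Q(X,Y)\to\mathfrak{M}_Q(X,Y)$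 is $\Phi(P,f) = P \cup Q \cup \bigcup_{y\in Y}(f(y)\times\{y\})$ (a bijection). -}

module Defs where

open import Data.Bool using (Bool; true; false)
open import Data.Nat using (ℕ)
open import Data.Fin using (Fin)
open import Data.Sum using (_⊎_; inj₁; inj₂)
open import Data.Product using (Σ; ∃; _×_; _,_)
open import Relation.Binary.PropositionalEquality using (_≡_)
open import Function.Bundles using (_⇔_)

-- A (decidable) binary relation on A, i.e. a subset of A × A given by its
-- characteristic function: (a , b) ∈ R  iff  R a b ≡ true.
BRel : Set → Set
BRel A = A → A → Bool

Subset : Set → Set
Subset A = A → Bool

_∈ₛ_ : {A : Set} → A → Subset A → Set
x ∈ₛ S = S x ≡ true

_≐_ : {A : Set} → BRel A → BRel A → Set
R ≐ R' = ∀ a b → R a b ≡ R' a b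

record IsPOR {A : Set} (R : BRel A) : Set where
  field
    refl  : ∀ a → R a a ≡ true
    antisym : ∀ a b → R a b ≡ true → R b a ≡ true → a ≡ b
    trans : ∀ a b c → R a b ≡ true → R b c ≡ true → R a c ≡ true

IsLowerEnd : {A : Set} → BRel A → Subset A → Set
IsLowerEnd R L = ∀ x l → R x l ≡ true → l ∈ₛ L → x ∈ₛ L

IsMax : {A : Set} → BRel A → A → Set
IsMax R x = ∀ y → R x y ≡ true → y ≡ x

-- Ground set X ∪ Y with X = Fin m, Y = Fin n, disjoint (tagged union).
U : ℕ → ℕ → Set
U m n = Fin m ⊎ Fin n

InY : {m n : ℕ} → U m n → Set
InY {m} {n} z = Σ (Fin n) (λ y → z ≡ inj₂ y)

YConvex : {m n : ℕ} → BRel (U m n) → Set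
YConvex {m} {n} R = ∀ (a b : Fin n) (x : U m n) →
  R (inj₂ a) x ≡ true → R x (inj₂ b) ≡ true → InY {m} {n} x

InF : {m n : ℕ} → BRel (Fin n) → BRel (Fin m) → (Fin n → Subset (Fin m)) → Set
InF {m} {n} Q P f =
  IsPOR P × (∀ y → IsLowerEnd P (f y)) ×
  (∀ a b → Q a b ≡ true → ∀ x → x ∈ₛ f a → x ∈ₛ f b)

InFStar : {m n : ℕ} → BRel (Fin n) → BRel (Fin m) → (Fin n → Subset (Fin m)) → Set
InFStar {m} {n} Q P f = InF Q P f × (∀ (x : Fin m) → Σ (Fin n) (λ y → x ∈ₛ f y))

InMStar : {m n : ℕ} → BRel (Fin n) → BRel (U m n) → Set
InMStar {m} {n} Q R =
  IsPOR R × (∀ a b → R (inj₂ a) (inj₂ b) ≡ Q a b) × YConvex {m} {n} R ×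
  (∀ (z : U m n) → IsMax R z ⇔ Σ (Fin n) (λ y → (z ≡ inj₂ y) × IsMax Q y))

-- Φ(P , f) = P ∪ Q ∪ ⋃_{y} f(y) × {y}.
Φ : {m n : ℕ} → BRel (Fin n) → BRel (Fin m) → (Fin n → Subset (Fin m)) → BRel (U m n)
Φ Q P f (inj₁ a) (inj₁ b) = P a b
Φ Q P f (inj₂ a) (inj₂ b) = Q a b
Φ Q P f (inj₁ x) (inj₂ y) = f y x
Φ Q P f (inj₂ y) (inj₁ x) = false

-- Φ is already a bijection from 𝔉_Q onto 𝔐_Q: P and f are read back off Φ(P,f) as its
-- restriction to X and the sets of X-points below each y. So the content is that the
-- covering condition X = ⋃ f(y) matches max R = max Q. If every x lies below some y, no x
-- is maximal, and since Y is an upper end the maxima in Y are those of Q. Conversely, in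
-- the finite poset R every point lies below a maximal one, which max R = max Q puts in Y;
-- this gives the covering, and convexity of Y then forbids y < x, so Y is an upper end and
-- R = Φ(R|X , y ↦ {x : x ≤ y}).
module Submission where

open import Defs
open import Data.Bool using (true; false; _≟_)
open import Data.Empty using (⊥-elim)
open import Data.Fin using (Fin)
open import Data.Fin.Induction using (spo-noetherian)
open import Data.Fin.Properties using (any?; +↔⊎)
open import Data.Nat using (ℕ)
open import Data.Product using (Σ; ∃-syntax; _×_; _,_; proj₁; proj₂)
open import Data.Sum using (_⊎_; inj₁; inj₂)
open import Data.Sum.Properties using (inj₁-injective; inj₂-injective)
open import Function.Base using (flip)
open import Function.Bundles using (_↠_; _⇔_; mk⇔; Surjection; Equivalence)
open import Function.Properties.Inverse using (↔⇒↠)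
open import Induction.WellFounded using (Acc; acc)
open import Relation.Binary.Structures using (IsStrictPartialOrder)
open import Relation.Nullary using (¬_; yes; no)
open import Relation.Nullary.Decidable using (_×-dec_)
open import Relation.Binary.PropositionalEquality
  using (_≡_; refl; sym; trans; cong; isEquivalence; resp₂)

-- Strict order read off R alone, so that no equality test on A is needed.
module StrictPart {A : Set} {R : BRel A} (isPOR : IsPOR R) where

  open IsPOR isPOR renaming (refl to R-refl; trans to R-trans; antisym to R-antisym)

  _<ᴿ_ : A → A → Set
  a <ᴿ b = R a b ≡ true × R b a ≡ false

  <ᴿ-irrefl : ∀ {a} → ¬ (a <ᴿ a)
  <ᴿ-irrefl {a} (_ , Raa≡false) with () ← trans (sym (R-refl a)) Raa≡false

  <ᴿ-trans : ∀ {a b c} → a <ᴿ b → b <ᴿ c → a <ᴿ c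
  <ᴿ-trans {a} {b} {c} (Rab , Rba≡false) (Rbc , _) = R-trans a b c Rab Rbc , Rca≡false
    where
    Rca≡false : R c a ≡ false
    Rca≡false with R c a in Rca
    ... | false = refl
    ... | true with () ← trans (sym (R-trans b c a Rbc Rca)) Rba≡false

  nothing-above⇒IsMax : ∀ {x} → (∀ y → ¬ (x <ᴿ y)) → IsMax R x
  nothing-above⇒IsMax {x} none y Rxy with R y x in Ryx
  ... | true  = R-antisym y x Ryx Rxy
  ... | false = ⊥-elim (none y (Rxy , Ryx))

module _ {A : Set} {k : ℕ} (enum : Fin k ↠ A) {R : BRel A} (isPOR : IsPOR R) where

  open Surjection enum using (to; strictlySurjective)
  open StrictPart isPOR

  private
    _⊏_ : Fin k → Fin k → Set
    i ⊏ j = to i <ᴿ to j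

    ⊏-isStrictPartialOrder : IsStrictPartialOrder _≡_ _⊏_
    ⊏-isStrictPartialOrder = record
      { isEquivalence = isEquivalence
      ; irrefl        = λ { refl → <ᴿ-irrefl }
      ; trans         = <ᴿ-trans
      ; <-resp-≈      = resp₂ _⊏_
      }

    above-or-IsMax : ∀ x → (∃[ j ] x <ᴿ to j) ⊎ IsMax R x
    above-or-IsMax x with any? (λ j → (R x (to j) ≟ true) ×-dec (R (to j) x ≟ false))
    ... | yes above = inj₁ above
    ... | no  none  = inj₂ (nothing-above⇒IsMax nothing-above)
      where
      nothing-above : ∀ y → ¬ (x <ᴿ y)
      nothing-above y x<y with j , refl ← strictlySurjective y = none (j , x<y)

    below-max-from : ∀ i → Acc (flip _⊏_) i → ∃[ w ] R (to i) w ≡ true × IsMax R w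
    below-max-from i (acc rs) with above-or-IsMax (to i)
    ... | inj₂ max = to i , IsPOR.refl isPOR (to i) , max
    ... | inj₁ (j , i⊏j) with w , Rjw , max ← below-max-from j (rs i⊏j) =
      w , IsPOR.trans isPOR _ _ _ (proj₁ i⊏j) Rjw , max

  below-max : ∀ x → ∃[ w ] R x w ≡ true × IsMax R w
  below-max x with i , refl ← strictlySurjective x =
    below-max-from i (spo-noetherian ⊏-isStrictPartialOrder i)

restrictX : ∀ {m n} → BRel (U m n) → BRel (Fin m)
restrictX R a b = R (inj₁ a) (inj₁ b)

↓X : ∀ {m n} → BRel (U m n) → Fin n → Subset (Fin m)
↓X R y x = R (inj₁ x) (inj₂ y)

module _ {m n : ℕ} {Q : BRel (Fin n)} where

  Φ-isPOR : IsPOR Q → {P : BRel (Fin m)} {f : Fin n → Subset (Fin m)} →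
    InF Q P f → IsPOR (Φ Q P f)
  Φ-isPOR isPOR-Q {P} {f} (isPOR-P , lowerEnd , monotone) = record
    { refl = Φ-refl ; antisym = Φ-antisym ; trans = Φ-trans }
    where
    R : BRel (U m n)
    R = Φ Q P f
    Φ-refl : ∀ a → R a a ≡ true
    Φ-refl (inj₁ x) = IsPOR.refl isPOR-P x
    Φ-refl (inj₂ y) = IsPOR.refl isPOR-Q y
    Φ-antisym : ∀ a b → R a b ≡ true → R b a ≡ true → a ≡ b
    Φ-antisym (inj₁ a) (inj₁ b) Rab Rba = cong inj₁ (IsPOR.antisym isPOR-P a b Rab Rba)
    Φ-antisym (inj₂ a) (inj₂ b) Rab Rba = cong inj₂ (IsPOR.antisym isPOR-Q a b Rab Rba)
    Φ-trans : ∀ a b c → R a b ≡ true → R b c ≡ true → R a c ≡ true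
    Φ-trans (inj₁ a) (inj₁ b) (inj₁ c) Rab Rbc = IsPOR.trans isPOR-P a b c Rab Rbc
    Φ-trans (inj₁ a) (inj₁ b) (inj₂ c) Rab Rbc = lowerEnd c a b Rab Rbc
    Φ-trans (inj₁ a) (inj₂ b) (inj₂ c) Rab Rbc = monotone b c Rbc a Rab
    Φ-trans (inj₂ a) (inj₂ b) (inj₂ c) Rab Rbc = IsPOR.trans isPOR-Q a b c Rab Rbc

  Φ-YConvex : (P : BRel (Fin m)) (f : Fin n → Subset (Fin m)) → YConvex (Φ Q P f)
  Φ-YConvex P f a b (inj₂ y) _ _ = y , refl

  Φ-IsMax⇔ : {P : BRel (Fin m)} {f : Fin n → Subset (Fin m)} → (∀ x → ∃[ y ] x ∈ₛ f y) →
    ∀ z → IsMax (Φ Q P f) z ⇔ Σ (Fin n) (λ y → (z ≡ inj₂ y) × IsMax Q y)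
  Φ-IsMax⇔ {P} {f} covers (inj₁ x) = mk⇔ not-max λ { (_ , () , _) }
    where
    not-max : IsMax (Φ Q P f) (inj₁ x) → Σ (Fin n) (λ y → (inj₁ x ≡ inj₂ y) × IsMax Q y)
    not-max max with () ← max (inj₂ (proj₁ (covers x))) (proj₂ (covers x))
  Φ-IsMax⇔ covers (inj₂ y) = mk⇔
    (λ max → y , refl , λ y′ Qyy′ → inj₂-injective (max (inj₂ y′) Qyy′))
    λ { (_ , refl , max) → λ { (inj₂ y′) Qyy′ → cong inj₂ (max y′ Qyy′) } }

  Φ-InMStar : IsPOR Q → (P : BRel (Fin m)) (f : Fin n → Subset (Fin m)) →
    InFStar Q P f → InMStar Q (Φ Q P f)
  Φ-InMStar isPOR-Q P f (inF , covers) =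
    Φ-isPOR isPOR-Q inF , (λ _ _ → refl) , Φ-YConvex P f , Φ-IsMax⇔ covers

  Φ-injective : {P P′ : BRel (Fin m)} {f f′ : Fin n → Subset (Fin m)} →
    Φ Q P f ≐ Φ Q P′ f′ → (P ≐ P′) × (∀ y x → f y x ≡ f′ y x)
  Φ-injective eq = (λ a b → eq (inj₁ a) (inj₁ b)) , (λ y x → eq (inj₁ x) (inj₂ y))

  module _ {R : BRel (U m n)} (R∈𝔐* : InMStar Q R) where

    private
      isPOR-R : IsPOR R
      isPOR-R = proj₁ R∈𝔐*
      R|Y≡Q : ∀ a b → R (inj₂ a) (inj₂ b) ≡ Q a b
      R|Y≡Q = proj₁ (proj₂ R∈𝔐*)
      Y-convex : YConvex R
      Y-convex = proj₁ (proj₂ (proj₂ R∈𝔐*))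
      IsMax⇔ : ∀ z → IsMax R z ⇔ Σ (Fin n) (λ y → (z ≡ inj₂ y) × IsMax Q y)
      IsMax⇔ = proj₂ (proj₂ (proj₂ R∈𝔐*))
      open IsPOR isPOR-R renaming (refl to R-refl; antisym to R-antisym; trans to R-trans)

    below-Y : ∀ z → ∃[ y ] R z (inj₂ y) ≡ true
    below-Y z with w , Rzw , max ← below-max (↔⇒↠ +↔⊎) isPOR-R z
              with y , refl , _ ← Equivalence.to (IsMax⇔ w) max = y , Rzw

    Y-upperEnd : ∀ y x → R (inj₂ y) (inj₁ x) ≡ false
    Y-upperEnd y x with R (inj₂ y) (inj₁ x) in Ryx
    ... | false = refl
    ... | true with y′ , Rxy′ ← below-Y (inj₁ x)
               with _ , () ← Y-convex y y′ (inj₁ x) Ryx Rxy′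

    restrict-InFStar : InFStar Q (restrictX R) (↓X R)
    restrict-InFStar = (isPOR-X , lowerEnd , monotone) , λ x → below-Y (inj₁ x)
      where
      isPOR-X : IsPOR (restrictX R)
      isPOR-X = record
        { refl    = λ a → R-refl (inj₁ a)
        ; antisym = λ a b Rab Rba → inj₁-injective (R-antisym _ _ Rab Rba)
        ; trans   = λ a b c → R-trans _ _ _
        }
      lowerEnd : ∀ y → IsLowerEnd (restrictX R) (↓X R y)
      lowerEnd y x l = R-trans _ _ _
      monotone : ∀ a b → Q a b ≡ true → ∀ x → x ∈ₛ ↓X R a → x ∈ₛ ↓X R b
      monotone a b Qab x Rxa = R-trans _ _ _ Rxa (trans (R|Y≡Q a b) Qab)

    Φ-restrict : Φ Q (restrictX R) (↓X R) ≐ R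
    Φ-restrict (inj₁ a) (inj₁ b) = refl
    Φ-restrict (inj₁ x) (inj₂ y) = refl
    Φ-restrict (inj₂ y) (inj₁ x) = sym (Y-upperEnd y x)
    Φ-restrict (inj₂ a) (inj₂ b) = sym (R|Y≡Q a b)

corollary1 : ∀ (m n : ℕ) (Q : BRel (Fin n)) → IsPOR Q →
    (∀ (P : BRel (Fin m)) (f : Fin n → Subset (Fin m)) →
    InFStar Q P f → InMStar Q (Φ Q P f))
    × (∀ (P P' : BRel (Fin m)) (f f' : Fin n → Subset (Fin m)) →
    InFStar Q P f → InFStar Q P' f' → Φ Q P f ≐ Φ Q P' f' →
    (P ≐ P') × (∀ y x → f y x ≡ f' y x))
    × (∀ (R : BRel (U m n)) → InMStar Q R →
    Σ (BRel (Fin m)) (λ P → Σ (Fin n → Subset (Fin m)) (λ f →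
    InFStar Q P f × (Φ Q P f ≐ R))))
corollary1 m n Q isPOR-Q =
    Φ-InMStar isPOR-Q
  , (λ _ _ _ _ _ _ → Φ-injective)
  , λ R R∈𝔐* → restrictX R , ↓X R , restrict-InFStar R∈𝔐* , Φ-restrict R∈𝔐*
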